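{- Let $\Gamma$ be a finite, simple, connected cubic graph and let $G\leq\mathrm{Aut}(\Gamma)$ be such that $\Gamma$ is $G$-locally-transitive. If $N$ is a normal subgroup of $G$ such that $G/N$ is insoluble, then $N$ has at least three orbits on the vertices of $\Gamma$ and $N$ is semiregular on the vertices of $\Gamma$. In particular, $\Gamma$ is a regular $N$-cover of $\Gamma/N$.
   Context: $\Gamma$ is $G$-locally-transitive if for every vertex $v$, the stabiliser $G_v$ acts transitively on the neighbourhood $\Gamma(v)$. A permutation group is semiregular if its only element fixing a point is the identity. The quotient graph $\Gamma/N$ has as vertices the $N$-orbits, two orbits being adjacent if some vertex of one is adjacent in $\Gamma$ to some vertex of the other. If the natural projection $\pi:\Gamma\to\Gamma/N$ restricts to a bijection from $\Gamma(v)$ to the neighbourhood of $v^N$ in $\Gamma/N$ for every vertex $v$, then $\Gamma$ is a regular $N$-cover of $\Gamma/N$. -}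

module Defs where

open import Data.Nat using (ℕ; zero; suc; _<_)
open import Data.Fin using (Fin)
open import Data.Fin.Permutation using (Permutation′; _⟨$⟩ʳ_; _⟨$⟩ˡ_; id; flip; _∘ₚ_; _≈_)
open import Data.Product using (Σ; ∃; _×_; _,_)
open import Data.Sum using (_⊎_)
open import Relation.Binary.PropositionalEquality using (_≡_; _≢_)
open import Relation.Binary.Construct.Closure.ReflexiveTransitive using (Star)
open import Relation.Nullary using (¬_)
open import Relation.Binary using (Decidable)
open import Function.Bundles using (_⇔_)


record Graph (n : ℕ) : Set₁ where
  field
    Adj     : Fin n → Fin n → Set
    adj?    : Decidable Adj
    sym     : ∀ {u v} → Adj u v → Adj v u
    irrefl  : ∀ {v} → ¬ Adj v v
open Graph public

Connected : ∀ {n} → Graph n → Set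
Connected Γ = ∀ u v → Star (Adj Γ) u v

Cubic : ∀ {n} → Graph n → Set
Cubic Γ = ∀ v → Σ (Fin _) λ a → Σ (Fin _) λ b → Σ (Fin _) λ c →
  (a ≢ b) × (a ≢ c) × (b ≢ c) ×
  Adj Γ v a × Adj Γ v b × Adj Γ v c ×
  (∀ w → Adj Γ v w → (w ≡ a) ⊎ (w ≡ b) ⊎ (w ≡ c))

PermSet : ℕ → Set₁
PermSet n = Permutation′ n → Set

_⊆_ : ∀ {n} → PermSet n → PermSet n → Set
H ⊆ K = ∀ p → H p → K p

_≐_ : ∀ {n} → PermSet n → PermSet n → Set
H ≐ K = (H ⊆ K) × (K ⊆ H)

record IsSubgroup {n} (H : PermSet n) : Set where
  field
    resp  : ∀ {p q} → p ≈ q → H p → H q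
    ∈-id  : H id
    ∈-∘   : ∀ {p q} → H p → H q → H (p ∘ₚ q)
    ∈-inv : ∀ {p} → H p → H (flip p)

IsAut : ∀ {n} → Graph n → Permutation′ n → Set
IsAut Γ g = ∀ u v → Adj Γ u v ⇔ Adj Γ (g ⟨$⟩ʳ u) (g ⟨$⟩ʳ v)

IsAutSubgroup : ∀ {n} → Graph n → PermSet n → Set
IsAutSubgroup Γ G = IsSubgroup G × (∀ g → G g → IsAut Γ g)

IsNormalIn : ∀ {n} → PermSet n → PermSet n → Set
IsNormalIn N K = IsSubgroup N × (N ⊆ K) ×
  (∀ g x → K g → N x → N ((flip g ∘ₚ x) ∘ₚ g))

[_,_] : ∀ {n} → Permutation′ n → Permutation′ n → Permutation′ n
[ x , y ] = ((flip x ∘ₚ flip y) ∘ₚ x) ∘ₚ y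

-- Via the correspondence theorem, a subnormal series
-- G/N = H₀/N ⊵ H₁/N ⊵ … ⊵ Hₖ/N = 1 with abelian factors is the same as a
-- chain G = H₀ ⊇ H₁ ⊇ … ⊇ Hₖ = N of subgroups containing N with
-- H_{i+1} ⊴ H_i and H_i/H_{i+1} abelian (i.e. [H_i,H_i] ⊆ H_{i+1}).
QuotientSoluble : ∀ {n} → PermSet n → PermSet n → Set₁
QuotientSoluble {n} G N = Σ ℕ λ k → Σ (ℕ → PermSet n) λ H →
  (H 0 ≐ G) × (H k ≐ N) ×
  (∀ i → i < k →
     IsSubgroup (H i) × (N ⊆ H i) × IsNormalIn (H (suc i)) (H i) ×
     (∀ x y → H i x → H i y → H (suc i) [ x , y ]))

LocallyTransitive : ∀ {n} → Graph n → PermSet n → Set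
LocallyTransitive Γ G = ∀ v u w → Adj Γ v u → Adj Γ v w →
  Σ (Permutation′ _) λ g → G g × (g ⟨$⟩ʳ v ≡ v) × (g ⟨$⟩ʳ u ≡ w)

SameOrbit : ∀ {n} → PermSet n → Fin n → Fin n → Set
SameOrbit N u w = Σ (Permutation′ _) λ x → N x × (x ⟨$⟩ʳ u ≡ w)

AtLeastThreeOrbits : ∀ {n} → PermSet n → Set
AtLeastThreeOrbits {n} N = Σ (Fin n) λ a → Σ (Fin n) λ b → Σ (Fin n) λ c →
  ¬ SameOrbit N a b × ¬ SameOrbit N a c × ¬ SameOrbit N b c

Semiregular : ∀ {n} → PermSet n → Set
Semiregular N = ∀ x v → N x → x ⟨$⟩ʳ v ≡ v → x ≈ id

QuotAdj : ∀ {n} → Graph n → PermSet n → Fin n → Fin n → Set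
QuotAdj Γ N u w = Σ (Fin _) λ x → Σ (Fin _) λ y →
  SameOrbit N u x × SameOrbit N w y × Adj Γ x y

-- Γ is a regular N-cover of Γ/N: for every v, u ↦ u^N is a bijection
-- from Γ(v) onto the neighbourhood of v^N in Γ/N.
-- (Well-definedness into that neighbourhood is automatic.)
RegularCover : ∀ {n} → Graph n → PermSet n → Set
RegularCover Γ N = ∀ v →
  (∀ u u' → Adj Γ v u → Adj Γ v u' → SameOrbit N u u' → u ≡ u')
  ×
  (∀ w → QuotAdj Γ N v w → Σ (Fin _) λ u → Adj Γ v u × SameOrbit N u w)

{-# OPTIONS --safe #-}
module Submission where

-- Suppose two distinct neighbours u, u′ of a vertex v lie in one N-orbit. Since G_v is transitive
-- on Γ(v), the whole of Γ(v) lies in one N-orbit, and so does Γ(y) for every neighbour y of u. If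
-- Γ(u) also lies in one orbit, walking along edges shows that N has at most the two orbits v^N and
-- u^N, which G permutes; otherwise every vertex is in u^N or adjacent to it, and G fixes u^N, as the
-- vertices adjacent to u^N, unlike u, have their neighbourhood in one orbit. Either way
-- [G, G] ≤ N G_r for some vertex r. Now G_r is soluble: it acts on Γ(r) through S₃, whose
-- derived subgroup A₃ is abelian, and the pointwise stabiliser of the ball of radius i + 1 acts on
-- Γ(y), for y at distance i + 1, through the stabiliser S₂ of a neighbour of y at distance i.
-- Multiplying this series by N gives a soluble series for G/N. Hence distinct neighbours lie in
-- distinct N-orbits, which is the covering property and gives three orbits; semiregularity
-- follows by connectedness, as an element of N fixing v must then fix each neighbour of v.

open import Algebra.Bundles using (CommutativeRing)
open import Data.Bool using (Bool; true; false; _xor_)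
open import Data.Bool.Properties using (xor-assoc; xor-∧-commutativeRing)
open import Algebra.Properties.CommutativeSemigroup
  (CommutativeRing.+-commutativeSemigroup xor-∧-commutativeRing) using (interchange)
open import Data.Empty using (⊥-elim)
open import Data.Fin using (Fin; zero; suc)
open import Data.Fin.Permutation
  using (Permutation′; _⟨$⟩ʳ_; _⟨$⟩ˡ_; id; flip; _∘ₚ_; _≈_; inverseˡ; inverseʳ)
open import Data.Fin.Properties using (_≟_; all?; any?)
import Data.List.Base as List
open import Data.List.Extrema.Nat using (max; xs≤max)
open import Data.List.Membership.Propositional.Properties using (∈-allFin)
import Data.List.Relation.Unary.All as ListAll
open import Data.List.Relation.Unary.All.Properties using (map⁻)
open import Data.Nat using (ℕ; zero; suc; _≤′_; ≤′-refl; ≤′-step)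
open import Data.Nat.Properties using (≤⇒≤′)
open import Data.Product using (Σ; ∃; _×_; _,_; proj₁; proj₂)
open import Data.Sum using (_⊎_; inj₁; inj₂; [_,_]′)
import Data.Sum as Sum
open import Data.Vec using (Vec; []; _∷_; lookup; tabulate; map)
open import Data.Vec.Properties using (lookup∘tabulate; tabulate∘lookup; tabulate-cong; lookup-map)
open import Data.Vec.Relation.Unary.All using ([]; _∷_)
open import Data.Vec.Relation.Unary.AllPairs using ([]; _∷_)
open import Data.Vec.Relation.Unary.Unique.Propositional using (Unique)
open import Data.Vec.Relation.Unary.Unique.Propositional.Properties using (lookup-injective)
open import Defs hiding (sym)
open import Function using (_∘_)
open import Function.Bundles using (Equivalence; Injection)
open import Function.Properties.Inverse using (↔⇒↣)
import Relation.Binary.Construct.Closure.ReflexiveTransitive as Star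
open import Relation.Binary.PropositionalEquality
  using (_≡_; _≢_; refl; sym; trans; cong; cong₂; subst; subst₂; module ≡-Reasoning)
open import Relation.Nullary using (¬_; Dec; yes; no; contradiction)
open import Relation.Nullary.Decidable using (from-yes; map′; _→-dec_; _⊎-dec_; ¬?)

-- Self-maps of Fin 3 as value tables, so that statements about them can be decided by enumeration.

Table : Set
Table = Vec (Fin 3) 3

infixl 5 _⨾_
_⨾_ : Table → Table → Table
σ ⨾ τ = map (lookup τ) σ

preimage : Table → Fin 3 → Fin 3
preimage σ i with any? (λ j → lookup σ j ≟ i)
... | yes (j , _) = j
... | no _        = i

inverseᵗ : Table → Table
inverseᵗ σ = tabulate (preimage σ)

commutatorᵗ : Table → Table → Table
commutatorᵗ σ τ = inverseᵗ σ ⨾ inverseᵗ τ ⨾ σ ⨾ τ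

rotate : Fin 3 → Fin 3
rotate zero             = suc zero
rotate (suc zero)       = suc (suc zero)
rotate (suc (suc zero)) = zero

Injectiveᵗ : Table → Set
Injectiveᵗ σ = ∀ i j → lookup σ i ≡ lookup σ j → i ≡ j

IsIdentityᵗ : Table → Set
IsIdentityᵗ σ = ∀ i → lookup σ i ≡ i

-- The even permutations of Fin 3 are exactly the maps commuting with the 3-cycle.
Evenᵗ : Table → Set
Evenᵗ σ = ∀ i → lookup σ (rotate i) ≡ rotate (lookup σ i)

injective? : ∀ σ → Dec (Injectiveᵗ σ)
injective? σ = all? λ i → all? λ j → (lookup σ i ≟ lookup σ j) →-dec (i ≟ j)

isIdentity? : ∀ σ → Dec (IsIdentityᵗ σ)
isIdentity? σ = all? λ i → lookup σ i ≟ i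

even? : ∀ σ → Dec (Evenᵗ σ)
even? σ = all? λ i → lookup σ (rotate i) ≟ rotate (lookup σ i)

∀-table? : {P : Table → Set} → (∀ σ → Dec (P σ)) → Dec (∀ σ → P σ)
∀-table? P? = map′ (λ h → λ { (a ∷ b ∷ c ∷ []) → h a b c }) (λ h a b c → h (a ∷ b ∷ c ∷ []))
  (all? λ a → all? λ b → all? λ c → P? (a ∷ b ∷ c ∷ []))

commutator-even : ∀ σ τ → Injectiveᵗ σ → Injectiveᵗ τ → Evenᵗ (commutatorᵗ σ τ)
commutator-even = from-yes (∀-table? λ σ → ∀-table? λ τ →
  injective? σ →-dec injective? τ →-dec even? (commutatorᵗ σ τ))

even-commutator-trivial : ∀ σ τ → Evenᵗ σ → Evenᵗ τ → IsIdentityᵗ (commutatorᵗ σ τ)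
even-commutator-trivial = from-yes (∀-table? λ σ → ∀-table? λ τ →
  even? σ →-dec even? τ →-dec isIdentity? (commutatorᵗ σ τ))

fixed-point-commutator-trivial : ∀ j σ τ → Injectiveᵗ σ → Injectiveᵗ τ →
  lookup σ j ≡ j → lookup τ j ≡ j → IsIdentityᵗ (commutatorᵗ σ τ)
fixed-point-commutator-trivial = from-yes (all? λ j → ∀-table? λ σ → ∀-table? λ τ →
  injective? σ →-dec injective? τ →-dec (lookup σ j ≟ j) →-dec (lookup τ j ≟ j) →-dec
  isIdentity? (commutatorᵗ σ τ))

even-inverse : ∀ σ → Evenᵗ σ → Evenᵗ (inverseᵗ σ)
even-inverse = from-yes (∀-table? λ σ → even? σ →-dec even? (inverseᵗ σ))

pairs-meet : ∀ (i j k l : Fin 3) → i ≢ j → k ≢ l → (k ≡ i ⊎ k ≡ j) ⊎ (l ≡ i ⊎ l ≡ j)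
pairs-meet = from-yes (all? λ (i : Fin 3) → all? λ (j : Fin 3) → all? λ (k : Fin 3) → all? λ (l : Fin 3) →
  ¬? (i ≟ j) →-dec ¬? (k ≟ l) →-dec ((k ≟ i ⊎-dec k ≟ j) ⊎-dec (l ≟ i ⊎-dec l ≟ j)))

table-ext : ∀ {σ τ : Table} → (∀ i → lookup σ i ≡ lookup τ i) → σ ≡ τ
table-ext {σ} {τ} σ≗τ = trans (sym (tabulate∘lookup σ)) (trans (tabulate-cong σ≗τ) (tabulate∘lookup τ))

lookup-⨾ : ∀ σ τ i → lookup (σ ⨾ τ) i ≡ lookup τ (lookup σ i)
lookup-⨾ σ τ i = lookup-map i (lookup τ) σ

even-⨾ : ∀ {σ τ} → Evenᵗ σ → Evenᵗ τ → Evenᵗ (σ ⨾ τ)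
even-⨾ {σ} {τ} σ-even τ-even i = begin
  lookup (σ ⨾ τ) (rotate i)          ≡⟨ lookup-⨾ σ τ (rotate i) ⟩
  lookup τ (lookup σ (rotate i))     ≡⟨ cong (lookup τ) (σ-even i) ⟩
  lookup τ (rotate (lookup σ i))     ≡⟨ τ-even (lookup σ i) ⟩
  rotate (lookup τ (lookup σ i))     ≡⟨ cong rotate (lookup-⨾ σ τ i) ⟨
  rotate (lookup (σ ⨾ τ) i)          ∎
  where open ≡-Reasoning

identity-even : ∀ {σ} → IsIdentityᵗ σ → Evenᵗ σ
identity-even {σ} σ-id i = trans (σ-id (rotate i)) (cong rotate (sym (σ-id i)))

lookup-inverseᵗ : ∀ {σ i j} → Injectiveᵗ σ → lookup σ j ≡ i → lookup (inverseᵗ σ) i ≡ j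
lookup-inverseᵗ {σ} {i} {j} σ-inj σj≡i = trans (lookup∘tabulate (preimage σ) i) (preimage-unique)
  where
  preimage-unique : preimage σ i ≡ j
  preimage-unique with any? (λ k → lookup σ k ≟ i)
  ... | yes (k , σk≡i) = σ-inj k j (trans σk≡i (sym σj≡i))
  ... | no ∄k          = contradiction (j , σj≡i) ∄k

infixr 9 _·_
_·_ : ∀ {n} → Permutation′ n → Fin n → Fin n
p · i = p ⟨$⟩ʳ i

·-injective : ∀ {n} (p : Permutation′ n) {i j} → p · i ≡ p · j → i ≡ j
·-injective p = Injection.injective (↔⇒↣ p)

flip-fixes : ∀ {n} (p : Permutation′ n) {r} → p · r ≡ r → flip p · r ≡ r
flip-fixes p {r} pr≡r = trans (cong (p ⟨$⟩ˡ_) (sym pr≡r)) (inverseˡ p)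

commutator-fixes : ∀ {n} {x y : Permutation′ n} {r} → x · r ≡ r → y · r ≡ r → [ x , y ] · r ≡ r
commutator-fixes {x = x} {y} {r} xr≡r yr≡r = begin
  y · x · flip y · flip x · r  ≡⟨ cong (λ z → y · x · flip y · z) (flip-fixes x xr≡r) ⟩
  y · x · flip y · r           ≡⟨ cong (λ z → y · x · z) (flip-fixes y yr≡r) ⟩
  y · x · r                    ≡⟨ cong (y ·_) xr≡r ⟩
  y · r                        ≡⟨ yr≡r ⟩
  r                            ∎
  where open ≡-Reasoning

module _ {n} {H : PermSet n} (H-sub : IsSubgroup H) where
  open IsSubgroup H-sub

  commutator-closed : ∀ {x y} → H x → H y → H [ x , y ]
  commutator-closed Hx Hy = ∈-∘ (∈-∘ (∈-∘ (∈-inv Hx) (∈-inv Hy)) Hx) Hy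

  -- g⁻¹ x g = x [x, g]
  normal-if-commutators : ∀ {K} → H ⊆ K → (∀ x y → K x → K y → H [ x , y ]) → IsNormalIn H K
  normal-if-commutators H⊆K K-comm = H-sub , H⊆K , λ g x Kg Hx →
    resp (λ i → cong (λ z → g · x · (g ⟨$⟩ˡ z)) (inverseˡ x)) (∈-∘ Hx (K-comm x g (H⊆K x Hx) Kg))

quotientSoluble-if-≐ : ∀ {n} {G N : PermSet n} → G ≐ N → QuotientSoluble G N
quotientSoluble-if-≐ {N = N} (G⊆N , N⊆G) =
  0 , (λ _ → N) , (N⊆G , G⊆N) , ((λ _ Ng → Ng) , (λ _ Ng → Ng)) , λ _ ()

Fixing : ∀ {n} → PermSet n → (Fin n → Set) → PermSet n
Fixing G X g = G g × (∀ z → X z → g · z ≡ z)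

Stabiliser : ∀ {n} → PermSet n → Fin n → PermSet n
Stabiliser G v = Fixing G (_≡ v)

fixing-subgroup : ∀ {n} {G : PermSet n} {X} → IsSubgroup G → IsSubgroup (Fixing G X)
fixing-subgroup G-sub = record
  { resp  = λ p≈q (Gp , p-fixes) → resp p≈q Gp , λ z Xz → trans (sym (p≈q z)) (p-fixes z Xz)
  ; ∈-id  = ∈-id , λ _ _ → refl
  ; ∈-∘   = λ {_} {q} (Gp , p-fixes) (Gq , q-fixes) →
              ∈-∘ Gp Gq , λ z Xz → trans (cong (q ·_) (p-fixes z Xz)) (q-fixes z Xz)
  ; ∈-inv = λ {p} (Gp , p-fixes) → ∈-inv Gp , λ z Xz → flip-fixes p (p-fixes z Xz)
  }
  where open IsSubgroup G-sub

module Quotient {n} {G N : PermSet n} (G-sub : IsSubgroup G) (N⊴G : IsNormalIn N G) where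
  private
    module G = IsSubgroup G-sub
    N-sub : IsSubgroup N
    N-sub = proj₁ N⊴G
    module N = IsSubgroup N-sub
    N⊆G : N ⊆ G
    N⊆G = proj₁ (proj₂ N⊴G)
    conjugate : ∀ {g x} → G g → N x → N ((flip g ∘ₚ x) ∘ₚ g)
    conjugate {g} {x} = proj₂ (proj₂ N⊴G) g x

  infix 4 _~_ _≡ₙ_
  infix 25 N⋆_

  _~_ : Fin n → Fin n → Set
  _~_ = SameOrbit N

  ~-refl : ∀ {a} → a ~ a
  ~-refl = id , N.∈-id , refl

  ~-sym : ∀ {a b} → a ~ b → b ~ a
  ~-sym (x , Nx , xa≡b) = flip x , N.∈-inv Nx , trans (cong (x ⟨$⟩ˡ_) (sym xa≡b)) (inverseˡ x)

  ~-trans : ∀ {a b c} → a ~ b → b ~ c → a ~ c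
  ~-trans (x , Nx , xa≡b) (y , Ny , yb≡c) = x ∘ₚ y , N.∈-∘ Nx Ny , trans (cong (y ·_) xa≡b) yb≡c

  ~-act : ∀ {g a b} → G g → a ~ b → g · a ~ g · b
  ~-act {g} Gg (x , Nx , xa≡b) =
    (flip g ∘ₚ x) ∘ₚ g , conjugate Gg Nx , cong (g ·_) (trans (cong (x ·_) (inverseˡ g)) xa≡b)

  ~-by : ∀ {m a} → N m → a ~ m · a
  ~-by Nm = _ , Nm , refl

  -- A record rather than a synonym for N (x ∘ₚ flip y), so that x and y can be inferred.
  record _≡ₙ_ (x y : Permutation′ n) : Set where
    constructor ≡ₙ-intro
    field ≡ₙ-elim : N (x ∘ₚ flip y)
  open _≡ₙ_

  ≡ₙ-refl : ∀ x → x ≡ₙ x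
  ≡ₙ-refl x = ≡ₙ-intro (N.resp (λ i → sym (inverseˡ x)) N.∈-id)

  ≡ₙ-trans : ∀ {x y z} → x ≡ₙ y → y ≡ₙ z → x ≡ₙ z
  ≡ₙ-trans {y = y} {z} (≡ₙ-intro x≡y) (≡ₙ-intro y≡z) =
    ≡ₙ-intro (N.resp (λ i → cong (z ⟨$⟩ˡ_) (inverseʳ y)) (N.∈-∘ x≡y y≡z))

  ≡ₙ-∘ : ∀ {x x′ y y′} → G x′ → x ≡ₙ x′ → y ≡ₙ y′ → x ∘ₚ y ≡ₙ x′ ∘ₚ y′
  ≡ₙ-∘ {x′ = x′} {y} Gx′ (≡ₙ-intro x≡x′) (≡ₙ-intro y≡y′) = ≡ₙ-trans {y = x′ ∘ₚ y}
    (≡ₙ-intro (N.resp (λ i → cong (x′ ⟨$⟩ˡ_) (sym (inverseˡ y))) x≡x′))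
    (≡ₙ-intro (conjugate (G.∈-inv Gx′) y≡y′))

  ≡ₙ-flip : ∀ {x y} → G x → x ≡ₙ y → flip x ≡ₙ flip y
  ≡ₙ-flip {x} Gx (≡ₙ-intro x≡y) = ≡ₙ-intro (N.resp (λ i → inverseʳ x) (conjugate Gx (N.∈-inv x≡y)))

  ≡ₙ-commutator : ∀ {x x′ y y′} → G x → G y → G x′ → G y′ → x ≡ₙ x′ → y ≡ₙ y′ →
    [ x , y ] ≡ₙ [ x′ , y′ ]
  ≡ₙ-commutator Gx Gy Gx′ Gy′ x≡x′ y≡y′ =
    ≡ₙ-∘ (G.∈-∘ (G.∈-∘ (G.∈-inv Gx′) (G.∈-inv Gy′)) Gx′)
      (≡ₙ-∘ (G.∈-∘ (G.∈-inv Gx′) (G.∈-inv Gy′))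
        (≡ₙ-∘ (G.∈-inv Gx′) (≡ₙ-flip Gx x≡x′) (≡ₙ-flip Gy y≡y′)) x≡x′) y≡y′

  N⋆_ : PermSet n → PermSet n
  (N⋆ T) g = Σ (Permutation′ n) λ t → T t × g ≡ₙ t

  ⋆-⊆ : ∀ {T} → T ⊆ G → N⋆ T ⊆ G
  ⋆-⊆ T⊆G g (t , Tt , g≡t) = G.resp (λ i → inverseʳ t) (G.∈-∘ (N⊆G _ (≡ₙ-elim g≡t)) (T⊆G t Tt))

  ⊆-⋆ : ∀ {T} → IsSubgroup T → N ⊆ N⋆ T
  ⊆-⋆ T-sub m Nm = id , IsSubgroup.∈-id T-sub , ≡ₙ-intro (N.resp (λ i → refl) Nm)

  ⋆-mono : ∀ {T T′} → T′ ⊆ T → N⋆ T′ ⊆ N⋆ T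
  ⋆-mono T′⊆T g (t , T′t , g≡t) = t , T′⊆T t T′t , g≡t

  ⋆-subgroup : ∀ {T} → IsSubgroup T → T ⊆ G → IsSubgroup (N⋆ T)
  ⋆-subgroup {T} T-sub T⊆G = record
    { resp  = λ p≈q (t , Tt , ≡ₙ-intro p≡t) →
                t , Tt , ≡ₙ-intro (N.resp (λ i → cong (t ⟨$⟩ˡ_) (p≈q i)) p≡t)
    ; ∈-id  = id , T.∈-id , ≡ₙ-refl id
    ; ∈-∘   = λ (t , Tt , p≡t) (u , Tu , q≡u) → t ∘ₚ u , T.∈-∘ Tt Tu , ≡ₙ-∘ (T⊆G t Tt) p≡t q≡u
    ; ∈-inv = λ {p} (t , Tt , p≡t) → flip t , T.∈-inv Tt , ≡ₙ-flip (⋆-⊆ T⊆G p (t , Tt , p≡t)) p≡t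
    }
    where module T = IsSubgroup T-sub

  ⋆-commutator : ∀ {T T′} → T ⊆ G → (∀ x y → T x → T y → T′ [ x , y ]) →
    ∀ x y → (N⋆ T) x → (N⋆ T) y → (N⋆ T′) [ x , y ]
  ⋆-commutator T⊆G T-comm x y (t , Tt , x≡t) (u , Tu , y≡u) =
    [ t , u ] , T-comm t u Tt Tu ,
    ≡ₙ-commutator (⋆-⊆ T⊆G x (t , Tt , x≡t)) (⋆-⊆ T⊆G y (u , Tu , y≡u)) (T⊆G t Tt) (T⊆G u Tu)
      x≡t y≡u

  ⋆-stabiliser : ∀ {g r} → G g → g · r ~ r → (N⋆ Stabiliser G r) g
  ⋆-stabiliser {g} Gg (m , Nm , mgr≡r) =
    g ∘ₚ m , (G.∈-∘ Gg (N⊆G m Nm) , λ { _ refl → mgr≡r }) ,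
    ≡ₙ-intro (N.resp (λ i → refl) (conjugate (G.∈-inv Gg) (N.∈-inv Nm)))

  -- The series G ⊇ N T₀ ⊇ N T₁ ⊇ … ⊇ N Tₖ = N; each term contains the commutators of the previous
  -- one and is therefore normal in it.
  quotientSoluble-of-series : (T : ℕ → PermSet n) (k : ℕ) →
    (∀ i → IsSubgroup (T i)) → T 0 ⊆ G → (∀ i → T (suc i) ⊆ T i) →
    (∀ i x y → T i x → T i y → T (suc i) [ x , y ]) →
    (∀ x y → G x → G y → (N⋆ T 0) [ x , y ]) →
    T k ⊆ N → QuotientSoluble G N
  quotientSoluble-of-series T k T-sub T₀⊆G T-desc T-comm G-comm Tₖ⊆N =
    suc k , H , ((λ _ Gg → Gg) , (λ _ Gg → Gg)) , (Hₖ⊆N , ⊆-⋆ (T-sub k)) , λ i _ →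
      H-sub i , N⊆H i , normal-if-commutators (H-sub (suc i)) (H-desc i) (H-comm i) , H-comm i
    where
    T⊆G : ∀ i → T i ⊆ G
    T⊆G zero    = T₀⊆G
    T⊆G (suc i) g Tg = T⊆G i g (T-desc i g Tg)

    H : ℕ → PermSet n
    H zero    = G
    H (suc i) = N⋆ T i

    H-sub : ∀ i → IsSubgroup (H i)
    H-sub zero    = G-sub
    H-sub (suc i) = ⋆-subgroup (T-sub i) (T⊆G i)

    N⊆H : ∀ i → N ⊆ H i
    N⊆H zero    = N⊆G
    N⊆H (suc i) = ⊆-⋆ (T-sub i)

    H-desc : ∀ i → H (suc i) ⊆ H i
    H-desc zero    = ⋆-⊆ T₀⊆G
    H-desc (suc i) = ⋆-mono (T-desc i)

    H-comm : ∀ i x y → H i x → H i y → H (suc i) [ x , y ]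
    H-comm zero    = G-comm
    H-comm (suc i) = ⋆-commutator (T⊆G i) (T-comm i)

    Hₖ⊆N : N⋆ T k ⊆ N
    Hₖ⊆N g (t , Tt , ≡ₙ-intro g≡t) = N.resp (λ i → inverseʳ t) (N.∈-∘ g≡t (Tₖ⊆N t Tt))

  -- G permutes the at most two orbits r false ^N and r true ^N, and Sym(2) is abelian.
  commutator-fixes-orbit-of-pair : (r : Bool → Fin n) →
    (∀ g → G g → Σ Bool λ s → ∀ b → g · r b ~ r (b xor s)) →
    ∀ {x y} → G x → G y → [ x , y ] · r false ~ r false
  commutator-fixes-orbit-of-pair r permutes {x} {y} Gx Gy =
    ~-trans (subst (λ b → [ x , y ] · r false ~ r b) reorder path) (~-sym (combine (undo Gx) (undo Gy)))
    where
    label : ∀ {g} → G g → Bool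
    label Gg = proj₁ (permutes _ Gg)

    move : ∀ {g} (Gg : G g) {z} b → z ~ r b → g · z ~ r (b xor label Gg)
    move Gg b z~rb = ~-trans (~-act Gg z~rb) (proj₂ (permutes _ Gg) b)

    undo : ∀ {g} (Gg : G g) → r false ~ r (label (G.∈-inv Gg) xor label Gg)
    undo {g} Gg = subst (_~ r (label (G.∈-inv Gg) xor label Gg)) (inverseʳ g)
      (move Gg _ (move (G.∈-inv Gg) false ~-refl))

    a = label (G.∈-inv Gx)
    b = label (G.∈-inv Gy)
    c = label Gx
    d = label Gy

    path : [ x , y ] · r false ~ r (((a xor b) xor c) xor d)
    path = move Gy _ (move Gx _ (move (G.∈-inv Gy) _ (move (G.∈-inv Gx) false ~-refl)))

    reorder : ((a xor b) xor c) xor d ≡ (a xor c) xor (b xor d)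
    reorder = trans (xor-assoc (a xor b) c d) (interchange a b c d)

    combine : ∀ {p q} → r false ~ r p → r false ~ r q → r false ~ r (p xor q)
    combine {false}        _    r~rq = r~rq
    combine {true} {false} r~rp _    = r~rp
    combine {true} {true}  _    _    = ~-refl

connected-induction : ∀ {n} {Γ : Graph n} → Connected Γ → (Q : Fin n → Set) →
  ∀ {a} → Q a → (∀ {c c′} → Adj Γ c c′ → Q c → Q c′) → ∀ z → Q z
connected-induction connected Q {a} Qa step z =
  Star.fold (λ c c′ → Q c → Q c′) (λ c→c′ k → k ∘ step c→c′) (λ Qc → Qc) (connected a z) Qa

module CubicGraph {n} (Γ : Graph n) (cubic : Cubic Γ) {G : PermSet n} (G≤AutΓ : IsAutSubgroup Γ G) where
  private
    G-sub : IsSubgroup G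
    G-sub = proj₁ G≤AutΓ
    module G-stabiliser {v} = IsSubgroup (fixing-subgroup {X = _≡ v} G-sub)

  adj-act : ∀ {g u v} → G g → Adj Γ u v → Adj Γ (g · u) (g · v)
  adj-act {g} {u} {v} Gg = Equivalence.to (proj₂ G≤AutΓ g Gg u v)

  adj-stabiliser : ∀ {g v w} → Stabiliser G v g → Adj Γ v w → Adj Γ v (g · w)
  adj-stabiliser {g} {v} (Gg , g-fixes) v—w =
    subst (λ u → Adj Γ u (g · _)) (g-fixes v refl) (adj-act Gg v—w)

  -- Opaque, as unfolding these definitions during unification makes type checking very slow.
  opaque
    neighbours : Fin n → Vec (Fin n) 3
    neighbours v = let (a , b , c , _) = cubic v in a ∷ b ∷ c ∷ []

    neighbour : Fin n → Fin 3 → Fin n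
    neighbour v = lookup (neighbours v)

    neighbour-adjacent : ∀ v i → Adj Γ v (neighbour v i)
    neighbour-adjacent v zero             = let (_ , _ , _ , _ , _ , _ , va , _ , _ , _) = cubic v in va
    neighbour-adjacent v (suc zero)       = let (_ , _ , _ , _ , _ , _ , _ , vb , _ , _) = cubic v in vb
    neighbour-adjacent v (suc (suc zero)) = let (_ , _ , _ , _ , _ , _ , _ , _ , vc , _) = cubic v in vc

    neighbour-injective : ∀ v {i j} → neighbour v i ≡ neighbour v j → i ≡ j
    neighbour-injective v = lookup-injective unique _ _
      where
      unique : Unique (neighbours v)
      unique = let (_ , _ , _ , a≢b , a≢c , b≢c , _) = cubic v
               in (a≢b ∷ a≢c ∷ []) ∷ (b≢c ∷ []) ∷ [] ∷ []

    neighbour-surjective : ∀ {v w} → Adj Γ v w → ∃ λ i → neighbour v i ≡ w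
    neighbour-surjective {v} {w} v—w =
      let (_ , _ , _ , _ , _ , _ , _ , _ , _ , only) = cubic v in position (only w v—w)
      where
      position : ∀ {a b c} → w ≡ a ⊎ w ≡ b ⊎ w ≡ c → ∃ λ i → lookup (a ∷ b ∷ c ∷ []) i ≡ w
      position (inj₁ refl)        = zero , refl
      position (inj₂ (inj₁ refl)) = suc zero , refl
      position (inj₂ (inj₂ refl)) = suc (suc zero) , refl

  opaque
    neighbourIndex : Fin n → Fin n → Fin 3
    neighbourIndex v w with any? (λ i → neighbour v i ≟ w)
    ... | yes (i , _) = i
    ... | no _        = zero  -- junk value for w ∉ Γ(v)

    neighbour-index : ∀ {v w} → Adj Γ v w → neighbour v (neighbourIndex v w) ≡ w
    neighbour-index {v} {w} v—w with any? (λ i → neighbour v i ≟ w)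
    ... | yes (_ , e) = e
    ... | no ∄i       = contradiction (neighbour-surjective v—w) ∄i

  index-neighbour : ∀ v i → neighbourIndex v (neighbour v i) ≡ i
  index-neighbour v i = neighbour-injective v (neighbour-index (neighbour-adjacent v i))

  neighbourIndex-injective : ∀ {v w w′} → Adj Γ v w → Adj Γ v w′ →
    neighbourIndex v w ≡ neighbourIndex v w′ → w ≡ w′
  neighbourIndex-injective {v} v—w v—w′ e =
    trans (sym (neighbour-index v—w)) (trans (cong (neighbour v) e) (neighbour-index v—w′))

  neighbour-pairs-meet : ∀ {v s t z w} → Adj Γ v s → Adj Γ v t → Adj Γ v z → Adj Γ v w → s ≢ t → z ≢ w →
    (z ≡ s ⊎ z ≡ t) ⊎ (w ≡ s ⊎ w ≡ t)
  neighbour-pairs-meet {v} {s} {t} {z} {w} v—s v—t v—z v—w s≢t z≢w =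
    Sum.map (Sum.map (same v—z v—s) (same v—z v—t)) (Sum.map (same v—w v—s) (same v—w v—t))
      (pairs-meet (neighbourIndex v s) (neighbourIndex v t) (neighbourIndex v z) (neighbourIndex v w)
        (s≢t ∘ same v—s v—t) (z≢w ∘ same v—z v—w))
    where same = neighbourIndex-injective

  opaque
    -- The permutation of Γ(v) ≅ Fin 3 induced by g ∈ G_v.
    local : Fin n → Permutation′ n → Table
    local v g = tabulate λ i → neighbourIndex v (g · neighbour v i)

    local-unique : ∀ {v g} i j → g · neighbour v i ≡ neighbour v j → lookup (local v g) i ≡ j
    local-unique {v} {g} i j e = begin
      lookup (local v g) i                  ≡⟨ lookup∘tabulate (λ k → neighbourIndex v (g · neighbour v k)) i ⟩
      neighbourIndex v (g · neighbour v i)  ≡⟨ cong (neighbourIndex v) e ⟩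
      neighbourIndex v (neighbour v j)      ≡⟨ index-neighbour v j ⟩
      j                                     ∎
      where open ≡-Reasoning

    local-spec : ∀ {v g} → Stabiliser G v g → ∀ i → neighbour v (lookup (local v g) i) ≡ g · neighbour v i
    local-spec {v} {g} g∈Gᵥ i =
      trans (cong (neighbour v) (lookup∘tabulate (λ k → neighbourIndex v (g · neighbour v k)) i))
        (neighbour-index (adj-stabiliser g∈Gᵥ (neighbour-adjacent v i)))

    local-resp : ∀ {v g h} → g ≈ h → local v g ≡ local v h
    local-resp {v} g≈h = tabulate-cong λ i → cong (neighbourIndex v) (g≈h (neighbour v i))

  local-injective : ∀ {v g} → Stabiliser G v g → Injectiveᵗ (local v g)
  local-injective {v} {g} g∈Gᵥ i j e = neighbour-injective v (·-injective g (begin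
    g · neighbour v i                      ≡⟨ local-spec g∈Gᵥ i ⟨
    neighbour v (lookup (local v g) i)     ≡⟨ cong (neighbour v) e ⟩
    neighbour v (lookup (local v g) j)     ≡⟨ local-spec g∈Gᵥ j ⟩
    g · neighbour v j                      ∎))
    where open ≡-Reasoning

  local-∘ : ∀ {v g h} → Stabiliser G v g → Stabiliser G v h → local v (g ∘ₚ h) ≡ local v g ⨾ local v h
  local-∘ {v} {g} {h} g∈Gᵥ h∈Gᵥ = table-ext λ i →
    trans (local-unique {v} {g ∘ₚ h} i (lookup (local v h) (lookup (local v g) i)) (begin
      h · g · neighbour v i                                      ≡⟨ cong (h ·_) (local-spec g∈Gᵥ i) ⟨
      h · neighbour v (lookup (local v g) i)                     ≡⟨ local-spec h∈Gᵥ _ ⟨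
      neighbour v (lookup (local v h) (lookup (local v g) i))    ∎))
    (sym (lookup-⨾ (local v g) (local v h) i))
    where open ≡-Reasoning

  local-flip : ∀ {v g} → Stabiliser G v g → local v (flip g) ≡ inverseᵗ (local v g)
  local-flip {v} {g} g∈Gᵥ = table-ext λ i →
    sym (lookup-inverseᵗ {local v g} (local-injective g∈Gᵥ)
      (local-unique {v} {g} (lookup (local v (flip g)) i) i (begin
      g · neighbour v (lookup (local v (flip g)) i)  ≡⟨ cong (g ·_) (local-spec (G-stabiliser.∈-inv g∈Gᵥ) i) ⟩
      g · flip g · neighbour v i                     ≡⟨ inverseʳ g ⟩
      neighbour v i                                  ∎)))
    where open ≡-Reasoning

  local-commutator : ∀ {v x y} → Stabiliser G v x → Stabiliser G v y →
    local v [ x , y ] ≡ commutatorᵗ (local v x) (local v y)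
  local-commutator {v} {x} {y} x∈Gᵥ y∈Gᵥ = begin
    local v [ x , y ]
      ≡⟨ local-∘ (∈-∘ (∈-∘ x⁻¹∈Gᵥ y⁻¹∈Gᵥ) x∈Gᵥ) y∈Gᵥ ⟩
    local v ((flip x ∘ₚ flip y) ∘ₚ x) ⨾ local v y
      ≡⟨ cong (_⨾ local v y) (local-∘ (∈-∘ x⁻¹∈Gᵥ y⁻¹∈Gᵥ) x∈Gᵥ) ⟩
    local v (flip x ∘ₚ flip y) ⨾ local v x ⨾ local v y
      ≡⟨ cong (λ σ → σ ⨾ local v x ⨾ local v y) (local-∘ x⁻¹∈Gᵥ y⁻¹∈Gᵥ) ⟩
    local v (flip x) ⨾ local v (flip y) ⨾ local v x ⨾ local v y
      ≡⟨ cong₂ (λ σ τ → σ ⨾ τ ⨾ local v x ⨾ local v y) (local-flip x∈Gᵥ) (local-flip y∈Gᵥ) ⟩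
    commutatorᵗ (local v x) (local v y)
      ∎
    where
    open ≡-Reasoning
    open G-stabiliser using (∈-∘; ∈-inv)
    x⁻¹∈Gᵥ = ∈-inv x∈Gᵥ
    y⁻¹∈Gᵥ = ∈-inv y∈Gᵥ

  local-identity : ∀ {v g} → (∀ i → g · neighbour v i ≡ neighbour v i) → IsIdentityᵗ (local v g)
  local-identity {v} {g} g-fixes i = local-unique {v} {g} i i (g-fixes i)

  local-identity-fixes : ∀ {v g w} → Stabiliser G v g → IsIdentityᵗ (local v g) → Adj Γ v w → g · w ≡ w
  local-identity-fixes {v} {g} {w} g∈Gᵥ σ-id v—w = begin
    g · w                                                     ≡⟨ cong (g ·_) (neighbour-index v—w) ⟨
    g · neighbour v (neighbourIndex v w)                      ≡⟨ local-spec g∈Gᵥ _ ⟨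
    neighbour v (lookup (local v g) (neighbourIndex v w))     ≡⟨ cong (neighbour v) (σ-id _) ⟩
    neighbour v (neighbourIndex v w)                          ≡⟨ neighbour-index v—w ⟩
    w                                                         ∎
    where open ≡-Reasoning

  fixing-stabiliser : ∀ {X g v} → Fixing G X g → X v → Stabiliser G v g
  fixing-stabiliser (Gg , g-fixes) Xv = Gg , λ { _ refl → g-fixes _ Xv }

  EvenStabiliser : Fin n → PermSet n
  EvenStabiliser v g = Stabiliser G v g × Evenᵗ (local v g)

  evenStabiliser-subgroup : ∀ {v} → IsSubgroup (EvenStabiliser v)
  evenStabiliser-subgroup {v} = record
    { resp  = λ g≈h (g∈Gᵥ , g-even) → resp g≈h g∈Gᵥ , subst Evenᵗ (local-resp g≈h) g-even
    ; ∈-id  = ∈-id , identity-even {local v id} (local-identity λ _ → refl)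
    ; ∈-∘   = λ {g} {h} (g∈Gᵥ , g-even) (h∈Gᵥ , h-even) →
                ∈-∘ g∈Gᵥ h∈Gᵥ ,
                subst Evenᵗ (sym (local-∘ g∈Gᵥ h∈Gᵥ)) (even-⨾ {local v g} {local v h} g-even h-even)
    ; ∈-inv = λ {g} (g∈Gᵥ , g-even) →
                ∈-inv g∈Gᵥ , subst Evenᵗ (sym (local-flip g∈Gᵥ)) (even-inverse (local v g) g-even)
    }
    where open G-stabiliser

  commutator-evenStabiliser : ∀ {v x y} → Stabiliser G v x → Stabiliser G v y → EvenStabiliser v [ x , y ]
  commutator-evenStabiliser {v} {x} {y} x∈Gᵥ y∈Gᵥ =
    commutator-closed (fixing-subgroup G-sub) x∈Gᵥ y∈Gᵥ ,
    subst Evenᵗ (sym (local-commutator x∈Gᵥ y∈Gᵥ))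
      (commutator-even (local v x) (local v y) (local-injective x∈Gᵥ) (local-injective y∈Gᵥ))

  evenStabiliser-commutator-fixes : ∀ {v x y w} → EvenStabiliser v x → EvenStabiliser v y →
    Adj Γ v w → [ x , y ] · w ≡ w
  evenStabiliser-commutator-fixes {v} {x} {y} (x∈Gᵥ , x-even) (y∈Gᵥ , y-even) =
    local-identity-fixes (commutator-closed (fixing-subgroup G-sub) x∈Gᵥ y∈Gᵥ)
      (subst IsIdentityᵗ (sym (local-commutator x∈Gᵥ y∈Gᵥ))
        (even-commutator-trivial (local v x) (local v y) x-even y-even))

  -- G_{vp} acts on Γ(v) through the abelian group S₂.
  arcStabiliser-commutator-fixes : ∀ {v p x y w} → Stabiliser G v x → Stabiliser G v y →
    Adj Γ v p → x · p ≡ p → y · p ≡ p → Adj Γ v w → [ x , y ] · w ≡ w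
  arcStabiliser-commutator-fixes {v} {p} {x} {y} x∈Gᵥ y∈Gᵥ v—p xp≡p yp≡p =
    local-identity-fixes (commutator-closed (fixing-subgroup G-sub) x∈Gᵥ y∈Gᵥ)
      (subst IsIdentityᵗ (sym (local-commutator x∈Gᵥ y∈Gᵥ))
        (fixed-point-commutator-trivial j (local v x) (local v y) (local-injective x∈Gᵥ) (local-injective y∈Gᵥ)
          (fixes-index xp≡p) (fixes-index yp≡p)))
    where
    j = neighbourIndex v p

    fixes-index : ∀ {g} → g · p ≡ p → lookup (local v g) j ≡ j
    fixes-index {g} gp≡p = local-unique {v} {g} j j (begin
      g · neighbour v j  ≡⟨ cong (g ·_) (neighbour-index v—p) ⟩
      g · p              ≡⟨ gp≡p ⟩
      p                  ≡⟨ neighbour-index v—p ⟨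
      neighbour v j      ∎)
      where open ≡-Reasoning

  Ball : Fin n → ℕ → Fin n → Set
  Ball r zero    z = z ≡ r
  Ball r (suc i) z = Ball r i z ⊎ ∃ λ y → Ball r i y × Adj Γ y z

  Ball-mono : ∀ {r i j z} → i ≤′ j → Ball r i z → Ball r j z
  Ball-mono ≤′-refl        z∈B = z∈B
  Ball-mono (≤′-step i≤j) z∈B = inj₁ (Ball-mono i≤j z∈B)

  module StabiliserSeries (connected : Connected Γ) (r : Fin n) where

    series : ℕ → PermSet n
    series zero          = Stabiliser G r
    series (suc zero)    = EvenStabiliser r
    series (suc (suc i)) = Fixing G (Ball r (suc i))

    series-subgroup : ∀ i → IsSubgroup (series i)
    series-subgroup zero          = fixing-subgroup G-sub
    series-subgroup (suc zero)    = evenStabiliser-subgroup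
    series-subgroup (suc (suc i)) = fixing-subgroup G-sub

    series-desc : ∀ i → series (suc i) ⊆ series i
    series-desc zero          _ = proj₁
    series-desc (suc zero)    g g∈F@(_ , g-fixes) =
      fixing-stabiliser g∈F (inj₁ refl) ,
      identity-even {local r g} (local-identity λ i → g-fixes _ (inj₂ (r , refl , neighbour-adjacent r i)))
    series-desc (suc (suc i)) _ (Gg , g-fixes) = Gg , λ z z∈B → g-fixes z (inj₁ z∈B)

    series-commutator : ∀ i x y → series i x → series i y → series (suc i) [ x , y ]
    series-commutator zero x y x∈Gᵣ y∈Gᵣ = commutator-evenStabiliser x∈Gᵣ y∈Gᵣ
    series-commutator (suc zero) x y x∈E@(x∈Gᵣ , _) y∈E@(y∈Gᵣ , _) =
      proj₁ [x,y]∈Gᵣ , λ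
        { _ (inj₁ refl)             → proj₂ [x,y]∈Gᵣ r refl
        ; _ (inj₂ (_ , refl , r—z)) → evenStabiliser-commutator-fixes x∈E y∈E r—z }
      where [x,y]∈Gᵣ = commutator-closed (fixing-subgroup G-sub) x∈Gᵣ y∈Gᵣ
    series-commutator (suc (suc i)) x y x∈F@(Gx , x-fixes) y∈F@(Gy , y-fixes) =
      commutator-closed G-sub Gx Gy , fixes
      where
      fixes : ∀ z → Ball r (suc (suc i)) z → [ x , y ] · z ≡ z
      fixes z (inj₁ z∈B) = commutator-fixes {x = x} {y} (x-fixes z z∈B) (y-fixes z z∈B)
      fixes z (inj₂ (u , inj₁ u∈B , u—z)) =
        commutator-fixes {x = x} {y} (x-fixes z (inj₂ (u , u∈B , u—z))) (y-fixes z (inj₂ (u , u∈B , u—z)))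
      fixes z (inj₂ (u , u∈B@(inj₂ (p , p∈B , p—u)) , u—z)) =
        arcStabiliser-commutator-fixes (fixing-stabiliser x∈F u∈B) (fixing-stabiliser y∈F u∈B)
          (Graph.sym Γ p—u) (x-fixes p (inj₁ p∈B)) (y-fixes p (inj₁ p∈B)) u—z

    reach : ∀ z → ∃ λ i → Ball r i z
    reach = connected-induction {Γ = Γ} connected (λ z → ∃ λ i → Ball r i z) (0 , refl)
      λ c—c′ (i , c∈B) → suc i , inj₂ (_ , c∈B , c—c′)

    radius : ℕ
    radius = max 0 (List.map (proj₁ ∘ reach) (List.allFin n))

    within-radius : ∀ z → Ball r radius z
    within-radius z = Ball-mono (≤⇒≤′ (ListAll.lookup (map⁻ (xs≤max 0 _)) (∈-allFin z))) (proj₂ (reach z))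

    series-trivial : ∀ {g} → series (suc (suc radius)) g → ∀ z → g · z ≡ z
    series-trivial (_ , g-fixes) z = g-fixes z (inj₁ (within-radius z))

module Solubility {n} (Γ : Graph n) (connected : Connected Γ) (cubic : Cubic Γ) {G N : PermSet n}
  (G≤AutΓ : IsAutSubgroup Γ G) (N⊴G : IsNormalIn N G) where
  private
    G-sub : IsSubgroup G
    G-sub = proj₁ G≤AutΓ
    module N = IsSubgroup (proj₁ N⊴G)
  open Quotient G-sub N⊴G
  open CubicGraph Γ cubic G≤AutΓ

  quotientSoluble-if-commutators-fix-orbit : ∀ r → (∀ {x y} → G x → G y → [ x , y ] · r ~ r) →
    QuotientSoluble G N
  quotientSoluble-if-commutators-fix-orbit r commutator-fixes-orbit =
    quotientSoluble-of-series series (suc (suc radius))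
      series-subgroup (λ _ → proj₁) series-desc series-commutator
      (λ x y Gx Gy → ⋆-stabiliser (commutator-closed G-sub Gx Gy) (commutator-fixes-orbit Gx Gy))
      (λ g g∈T → N.resp (λ z → sym (series-trivial g∈T z)) N.∈-id)
    where open StabiliserSeries connected r

module OrbitAnalysis {n} (Γ : Graph n) (connected : Connected Γ) (cubic : Cubic Γ) {G N : PermSet n}
  (G≤AutΓ : IsAutSubgroup Γ G) (locallyTransitive : LocallyTransitive Γ G) (N⊴G : IsNormalIn N G) where
  private
    G-sub : IsSubgroup G
    G-sub = proj₁ G≤AutΓ
    module G = IsSubgroup G-sub
    N⊆G : N ⊆ G
    N⊆G = proj₁ (proj₂ N⊴G)
  open Quotient G-sub N⊴G
  open CubicGraph Γ cubic G≤AutΓ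
  open Solubility Γ connected cubic G≤AutΓ N⊴G

  NeighbourhoodInOneOrbit : Fin n → Set
  NeighbourhoodInOneOrbit v = ∀ {w w′} → Adj Γ v w → Adj Γ v w′ → w ~ w′

  neighbourhoodInOneOrbit-act : ∀ {g v} → G g → NeighbourhoodInOneOrbit v → NeighbourhoodInOneOrbit (g · v)
  neighbourhoodInOneOrbit-act {g} {v} Gg one-orbit gv—w gv—w′ =
    subst₂ _~_ (inverseʳ g) (inverseʳ g) (~-act Gg (one-orbit (pull gv—w) (pull gv—w′)))
    where
    pull : ∀ {w} → Adj Γ (g · v) w → Adj Γ v (flip g · w)
    pull gv—w = subst (λ u → Adj Γ u _) (inverseˡ g) (adj-act (G.∈-inv Gg) gv—w)

  neighbourhoodInOneOrbit-unact : ∀ {g v} → G g → NeighbourhoodInOneOrbit (g · v) → NeighbourhoodInOneOrbit v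
  neighbourhoodInOneOrbit-unact {g} Gg one-orbit =
    subst NeighbourhoodInOneOrbit (inverseˡ g) (neighbourhoodInOneOrbit-act (G.∈-inv Gg) one-orbit)

  orbit-neighbours : ∀ {c d c′ e} → NeighbourhoodInOneOrbit d → c ~ d → Adj Γ c c′ → Adj Γ d e → c′ ~ e
  orbit-neighbours one-orbit (m , Nm , mc≡d) c—c′ d—e =
    ~-trans (~-by Nm) (one-orbit (subst (λ u → Adj Γ u (m · _)) mc≡d (adj-act (N⊆G m Nm) c—c′)) d—e)

  -- G_v is transitive on the three neighbours of v, so an N-orbit containing two of them contains all three.
  neighbourhoodInOneOrbit-if-two : ∀ {v s t} → Adj Γ v s → Adj Γ v t → s ≢ t → s ~ t →
    NeighbourhoodInOneOrbit v
  neighbourhoodInOneOrbit-if-two {v} {s} {t} v—s v—t s≢t s~t v—w v—w′ =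
    ~-trans (in-orbit-of-s v—w) (~-sym (in-orbit-of-s v—w′))
    where
    pair-in-orbit-of-s : ∀ {w} → w ≡ s ⊎ w ≡ t → w ~ s
    pair-in-orbit-of-s (inj₁ refl) = ~-refl
    pair-in-orbit-of-s (inj₂ refl) = ~-sym s~t

    in-orbit-of-s : ∀ {z} → Adj Γ v z → z ~ s
    in-orbit-of-s {z} v—z =
      let (h , Gh , hv≡v , hs≡z) = locallyTransitive v s z v—s v—z
          v—ht = subst (λ u → Adj Γ u (h · t)) hv≡v (adj-act Gh v—t)
          z≢ht = λ z≡ht → s≢t (·-injective h (trans hs≡z z≡ht))
          z~ht = subst (_~ h · t) hs≡z (~-act Gh s~t)
      in [ pair-in-orbit-of-s , (λ ht∈st → ~-trans z~ht (pair-in-orbit-of-s ht∈st)) ]′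
           (neighbour-pairs-meet v—s v—t v—z v—ht s≢t z≢ht)

  two-orbits-cover : ∀ {a b} → NeighbourhoodInOneOrbit a → NeighbourhoodInOneOrbit b → Adj Γ a b →
    ∀ z → z ~ a ⊎ z ~ b
  two-orbits-cover {a} {b} a-one-orbit b-one-orbit a—b =
    connected-induction {Γ = Γ} connected (λ z → z ~ a ⊎ z ~ b) (inj₁ ~-refl) λ
      { c—c′ (inj₁ c~a) → inj₂ (orbit-neighbours a-one-orbit c~a c—c′ a—b)
      ; c—c′ (inj₂ c~b) → inj₁ (orbit-neighbours b-one-orbit c~b c—c′ (Graph.sym Γ a—b)) }

  quotientSoluble-if-adjacent-in-one-orbit : ∀ {v u} → NeighbourhoodInOneOrbit v → NeighbourhoodInOneOrbit u →
    Adj Γ v u → QuotientSoluble G N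
  quotientSoluble-if-adjacent-in-one-orbit {v} {u} v-one-orbit u-one-orbit v—u =
    quotientSoluble-if-commutators-fix-orbit v (commutator-fixes-orbit-of-pair r permutes)
    where
    r : Bool → Fin n
    r false = v
    r true  = u

    permutes : ∀ g → G g → Σ Bool λ s → ∀ b → g · r b ~ r (b xor s)
    permutes g Gg with two-orbits-cover v-one-orbit u-one-orbit v—u (g · v)
    ... | inj₁ gv~v = false , λ
      { false → gv~v
      ; true  → orbit-neighbours v-one-orbit gv~v (adj-act Gg v—u) v—u }
    ... | inj₂ gv~u = true , λ
      { false → gv~u
      ; true  → orbit-neighbours u-one-orbit gv~u (adj-act Gg v—u) (Graph.sym Γ v—u) }

  InOrAdjacentToOrbit : Fin n → Fin n → Set
  InOrAdjacentToOrbit u z = z ~ u ⊎ ∃ λ z′ → z′ ~ u × Adj Γ z′ z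

  inOrAdjacentToOrbit-everywhere : ∀ {u} → (∀ {y} → Adj Γ u y → NeighbourhoodInOneOrbit y) →
    ∀ z → InOrAdjacentToOrbit u z
  inOrAdjacentToOrbit-everywhere {u} neighbours-one-orbit =
    connected-induction {Γ = Γ} connected (InOrAdjacentToOrbit u) (inj₁ ~-refl) step
    where
    step : ∀ {c c′} → Adj Γ c c′ → InOrAdjacentToOrbit u c → InOrAdjacentToOrbit u c′
    step c—c′ (inj₁ c~u) = inj₂ (_ , c~u , c—c′)
    step {c} c—c′ (inj₂ (_ , (m , Nm , mz′≡u) , z′—c)) =
      let u—mc = subst (λ w → Adj Γ w (m · c)) mz′≡u (adj-act (N⊆G m Nm) z′—c)
      in inj₁ (orbit-neighbours (neighbours-one-orbit u—mc) (~-by Nm) c—c′ (Graph.sym Γ u—mc))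

  orbit-invariant-if-not-in-one-orbit : ∀ {u} → (∀ {y} → Adj Γ u y → NeighbourhoodInOneOrbit y) →
    ¬ NeighbourhoodInOneOrbit u → ∀ {g} → G g → g · u ~ u
  orbit-invariant-if-not-in-one-orbit {u} neighbours-one-orbit not-one-orbit {g} Gg
    with inOrAdjacentToOrbit-everywhere neighbours-one-orbit (g · u)
  ... | inj₁ gu~u = gu~u
  ... | inj₂ (_ , (m , Nm , mz′≡u) , z′—gu) =
    let u—mgu = subst (λ w → Adj Γ w (m · g · u)) mz′≡u (adj-act (N⊆G m Nm) z′—gu)
    in ⊥-elim (not-one-orbit
         (neighbourhoodInOneOrbit-unact (G.∈-∘ Gg (N⊆G m Nm)) (neighbours-one-orbit u—mgu)))

  neighbours-in-distinct-orbits : ¬ QuotientSoluble G N →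
    ∀ {v u u′} → Adj Γ v u → Adj Γ v u′ → u ~ u′ → u ≡ u′
  neighbours-in-distinct-orbits insoluble {v} {u} {u′} v—u v—u′ u~u′ with u ≟ u′
  ... | yes u≡u′ = u≡u′
  ... | no u≢u′  = ⊥-elim (not-not-in-one-orbit not-in-one-orbit)  -- the goal is ⊥, so the case need not be decided
    where
    v-one-orbit : NeighbourhoodInOneOrbit v
    v-one-orbit = neighbourhoodInOneOrbit-if-two v—u v—u′ u≢u′ u~u′

    neighbours-one-orbit : ∀ {y} → Adj Γ u y → NeighbourhoodInOneOrbit y
    neighbours-one-orbit u—y =
      let (h , Gh , _ , hv≡y) = locallyTransitive u v _ (Graph.sym Γ v—u) u—y
      in subst NeighbourhoodInOneOrbit hv≡y (neighbourhoodInOneOrbit-act Gh v-one-orbit)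

    not-in-one-orbit : ¬ NeighbourhoodInOneOrbit u
    not-in-one-orbit u-one-orbit =
      insoluble (quotientSoluble-if-adjacent-in-one-orbit v-one-orbit u-one-orbit v—u)

    not-not-in-one-orbit : ¬ ¬ NeighbourhoodInOneOrbit u
    not-not-in-one-orbit not-one-orbit = insoluble (quotientSoluble-if-commutators-fix-orbit u λ Gx Gy →
      orbit-invariant-if-not-in-one-orbit neighbours-one-orbit not-one-orbit (commutator-closed G-sub Gx Gy))

  semiregular : ¬ QuotientSoluble G N → Semiregular N
  semiregular insoluble x v Nx xv≡v = connected-induction {Γ = Γ} connected (λ z → x · z ≡ z) xv≡v step
    where
    step : ∀ {c c′} → Adj Γ c c′ → x · c ≡ c → x · c′ ≡ c′
    step {c} {c′} c—c′ xc≡c = sym (neighbours-in-distinct-orbits insoluble c—c′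
      (subst (λ w → Adj Γ w (x · c′)) xc≡c (adj-act (N⊆G x Nx) c—c′)) (~-by Nx))

  regularCover : ¬ QuotientSoluble G N → RegularCover Γ N
  regularCover insoluble v = (λ _ _ → neighbours-in-distinct-orbits insoluble) , lift
    where
    lift : ∀ w → QuotAdj Γ N v w → ∃ λ u → Adj Γ v u × u ~ w
    lift w (_ , y , (m , Nm , mv≡x) , w~y , x—y) =
      flip m · y ,
      subst (λ u → Adj Γ u (flip m · y)) (trans (cong (m ⟨$⟩ˡ_) (sym mv≡x)) (inverseˡ m))
        (adj-act (G.∈-inv (N⊆G m Nm)) x—y) ,
      ~-trans (m , Nm , inverseʳ m) (~-sym w~y)

  atLeastThreeOrbits : ¬ QuotientSoluble G N → Fin n → AtLeastThreeOrbits N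
  atLeastThreeOrbits insoluble v =
    let (a , b , c , a≢b , a≢c , b≢c , v—a , v—b , v—c , _) = cubic v
    in a , b , c , a≢b ∘ distinct v—a v—b , a≢c ∘ distinct v—a v—c , b≢c ∘ distinct v—b v—c
    where distinct = neighbours-in-distinct-orbits insoluble

quotientSoluble-on-no-points : ∀ {G N : PermSet 0} → IsNormalIn N G → QuotientSoluble G N
quotientSoluble-on-no-points (N-sub , N⊆G , _) =
  quotientSoluble-if-≐ ((λ _ _ → IsSubgroup.resp N-sub (λ ()) (IsSubgroup.∈-id N-sub)) , N⊆G)

lemma4p10 : ∀ {n} (Γ : Graph n) (G N : PermSet n) →
    Connected Γ → Cubic Γ →
    IsAutSubgroup Γ G → LocallyTransitive Γ G →
    IsNormalIn N G → ¬ QuotientSoluble G N →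
    AtLeastThreeOrbits N × Semiregular N × RegularCover Γ N
lemma4p10 {zero} Γ G N _ _ _ _ N⊴G insoluble = ⊥-elim (insoluble (quotientSoluble-on-no-points N⊴G))
lemma4p10 {suc n} Γ G N connected cubic G≤AutΓ locallyTransitive N⊴G insoluble =
  atLeastThreeOrbits insoluble zero , semiregular insoluble , regularCover insoluble
  where open OrbitAnalysis Γ connected cubic G≤AutΓ locallyTransitive N⊴G
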